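{- In the setting described in the context, for every subgraph $G=\langle V,E\rangle$ of $G_\star$ (i.e. $E\subseteq E_\star$), the automaton $\mathcal A$ accepts the labeled tree $\mathcal T_G$ if and only if there exists a path in $\Gamma_G$ from the vertex $(0,\pi_{init})$ to the vertex $\top$ whose label is a Dyck word.
   Context: Fix a positive integer $\kappa$, an MSO formula $\varphi$, and let $K=4\kappa+3$ and $\Sigma=2^{\{0,\dots,K\}}\times 2^{\{0,\dots,K\}}\times 2^{\{0,\dots,K\}^2}$. Tree automata: a (deterministic, bottom-up) tree automaton is $\mathcal A=\langle Q,\Sigma,\iota,Q_{end},\delta\rangle$ with finite state set $Q$, initial state $\iota$, accepting states $Q_{end}\subseteq Q$ and $\delta:Q^2\times\Sigma\to Q$. The run $\rho$ on a $\Sigma$-labeled binary ordered tree (every internal node has a left child and a right child) is given by $\rho(n)=\delta(\iota,\iota,\lambda(n))$ for a leaf $n$ and $\rho(n)=\delta(\rho(m_1),\rho(m_2),\lambda(n))$ for an internal node with left child $m_1$ and right child $m_2$; $\mathcal A$ accepts if $\rho(\text{root})\in Q_{end}$. Tree decompositions: a tree decomposition of a graph $\langle V,E\rangle$ is $\langle\mathcal T,\mathbf T\rangle$ with $\mathcal T$ a tree and bags $\mathbf T(n)\subseteq V$ such that each edge lies in $\mathbf T(n)^2$ for some $n$ and, for each $v$, the nodes whose bag contains $v$ form a non-empty connected subtree; width = max bag size minus 1. Given a binary ordered tree decomposition $\mathcal D=\langle\mathcal T,\mathbf T\rangle$ of width at most $K$, a proper $\mathcal D$-coloring is $\chi:V\to\{0,\dots,K\}$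 injective on every bag. The $(\chi,\mathcal D)$-succinct tree decomposition of $\langle V,E\rangle$ is $\mathcal T$ with each node $n$ labeled $\langle\chi(A),\chi(B),\chi(C)\rangle\in\Sigma$, where $A=\mathbf T(n)\cap\mathbf T(m)$ if $n$ has parent $m$ and $A=\emptyset$ at the root, $B=\mathbf T(n)\setminus A$, $C=\{(v,w)\in E : (v,w)\in\mathbf T(n)^2\setminus A^2\}$, and $\chi$ is applied elementwise (componentwise on pairs). Assumption on $\mathcal A$: $\mathcal A$ is a tree automaton over $\Sigma$ such that for every graph $G$ and every succinct tree decomposition $\mathcal T$ of $G$ of width $K$, $G\models\varphi$ iff $\mathcal A$ accepts $\mathcal T$. Setting: $G_\star=\langle V,E_\star\rangle$ is a graph, $\mathcal D_\star=\langle\mathcal T_\star,\mathbf T_\star\rangle$ is a binary ordered tree decomposition of $G_\star$ of width at most $K$ with $N$ nodes, and $\chi$ is a proper $\mathcal D_\star$-coloring. For $E\subseteq E_\star$, $\mathcal D_\star$ is also a tree decomposition of $G=\langle V,E\rangle$; let $\Lambda_G$ be the node labeling making $\mathcal T_\star$ the $(\chi,\mathcal D_\star)$-succinct tree decomposition $\mathcal T_G$ of $G$. Let $n_1,\dots,n_N$ be the nodes of $\mathcal T_\star$ in post order (descendants before ancestors; a left subtree entirely before the right subtree), and $\mathcal S_i=\{n : \mathrm{post}(n)\le i,\ \mathrm{post}(m)>i \text{ for all strict ancestors } m\}$ for $0\le i\le N$. For $1\le i\le N$, $\gamma\in\Sigma$ and $\pi:\mathcal S_{i-1}\to Q$, define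 $\Pi_i(\pi,\gamma):\mathcal S_i\to Q$ by $\Pi_i(\pi,\gamma)(n)=\pi(n)$ for $n\in\mathcal S_{i-1}\cap\mathcal S_i$, and at $n_i$: $\delta(\iota,\iota,\gamma)$ if $n_i$ is a leaf, $\delta(\pi(m_1),\pi(m_2),\gamma)$ if $n_i$ has left child $m_1$ and right child $m_2$. Let $\pi_{init}$ be the unique function $\emptyset\to Q$. The labeled graph $\Gamma_G$: vertices are all pairs $(i,\pi)$ with $0\le i\le N$ and $\pi:\mathcal S_i\to Q$, the vertices $(i-1)$ and $(i-1,\gamma)$ for $1\le i\le N$ and $\gamma\in\Sigma$, and a vertex $\top$. Labels are $(i,\pi)^+$, $(i,\pi)^-$ and a neutral label $\bullet$. Edges: for $1\le i\le N$, all $\pi:\mathcal S_{i-1}\to Q$ and all $\gamma\in\Sigma$, an edge $(i-1,\pi)\to(i-1)$ labeled $(i-1,\pi)^+$ and an edge $(i-1,\gamma)\to(i,\Pi_i(\pi,\gamma))$ labeled $(i-1,\pi)^-$; for each $1\le i\le N$ one edge $(i-1)\to(i-1,\Lambda_G(n_i))$ labeled $\bullet$; and edges $(N,\pi)\to\top$ labeled $\bullet$ for every $\pi:\mathcal S_N\to Q$ with $\pi(n_N)\in Q_{end}$. Dyck words: words over the labels generated by $S\to\varepsilon\mid S\,\bullet\,S\mid S\,x^+\,S\,x^-\,S$, where $x$ ranges over the pairs $(i,\pi)$; the label of a path is the concatenation of its edge labels. -}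

module Defs where

open import Data.Nat using (ℕ; zero; suc; _+_; _*_; _≤_; _<_)
open import Data.Bool using (Bool; true; false; _∧_; _∨_; not; T)
open import Data.Fin using (Fin; zero; suc; _≟_)
open import Data.Fin.Subset using (Subset; _∈_; _∩_; _─_; ∣_∣; ⊥)
open import Data.Vec using (Vec; tabulate; lookup)
open import Data.List using (List; []; _∷_; _++_; [_])
open import Data.Product using (Σ; ∃; ∃-syntax; _×_; _,_)
open import Data.Sum using (_⊎_)
open import Relation.Nullary.Decidable using (⌊_⌋)
open import Relation.Binary.PropositionalEquality using (_≡_)

Kof : ℕ → ℕ
Kof κ = 4 * κ + 3

-- a subset of {0..K}² is a (K+1)×(K+1) Boolean matrix (row = first coord)
Sym : ℕ → Set
Sym K = Subset (suc K) × Subset (suc K) × Vec (Subset (suc K)) (suc K)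

record Automaton (S : Set) : Set where
  field
    q    : ℕ
    ι    : Fin q
    Qend : Subset q
    δ    : Fin q → Fin q → S → Fin q

data Dir : Set where
  L R : Dir

Pos : Set
Pos = List Dir

data BTree : Set where
  leaf : BTree
  node : BTree → BTree → BTree

data At : BTree → Pos → BTree → Set where
  here : ∀ {t} → At t [] t
  goL  : ∀ {l r p s} → At l p s → At (node l r) (L ∷ p) s
  goR  : ∀ {l r p s} → At r p s → At (node l r) (R ∷ p) s

IsNode : BTree → Pos → Set
IsNode t p = ∃[ s ] At t p s

size : BTree → ℕ
size leaf = 1
size (node l r) = suc (size l + size r)

-- post-order number (1-based; left subtree, right subtree, then node)
post : BTree → Pos → ℕ
post leaf _ = 1
post (node l r) [] = suc (size l + size r)
post (node l r) (L ∷ p) = post l p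
post (node l r) (R ∷ p) = size l + post r p

_≺_ : Pos → Pos → Set
m ≺ n = ∃[ d ] ∃[ s ] m ++ d ∷ s ≡ n

_≼_ : Pos → Pos → Set
m ≼ n = ∃[ s ] m ++ s ≡ n

OnPath : Pos → Pos → Pos → Set
OnPath n m u = (u ≼ n ⊎ u ≼ m) × (∀ w → w ≼ n → w ≼ m → w ≼ u)

InS : BTree → ℕ → Pos → Set
InS t i n = IsNode t n × post t n ≤ i × (∀ m → m ≺ n → i < post t m)

record IsTreeDecomposition (K nV : ℕ) (E : Fin nV → Fin nV → Bool)
                           (t : BTree) (bag : Pos → Subset nV) : Set where
  field
    width≤   : ∀ n → IsNode t n → ∣ bag n ∣ ≤ suc K
    covers   : ∀ v w → T (E v w) → ∃[ n ] IsNode t n × v ∈ bag n × w ∈ bag n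
    nonempty : ∀ v → ∃[ n ] IsNode t n × v ∈ bag n
    connected : ∀ v n m u → IsNode t n → IsNode t m → v ∈ bag n → v ∈ bag m →
                OnPath n m u → v ∈ bag u

ProperColoring : (K nV : ℕ) → BTree → (Pos → Subset nV) → (Fin nV → Fin (suc K)) → Set
ProperColoring K nV t bag χ =
  ∀ n → IsNode t n → ∀ v w → v ∈ bag n → w ∈ bag n → χ v ≡ χ w → v ≡ w

anyF : ∀ {n} → (Fin n → Bool) → Bool
anyF {zero} f = false
anyF {suc n} f = f zero ∨ anyF (λ i → f (suc i))

image : ∀ {nV k} → (Fin nV → Fin k) → Subset nV → Subset k
image χ S = tabulate λ c → anyF λ v → lookup S v ∧ ⌊ χ v ≟ c ⌋

image² : ∀ {nV k} → (Fin nV → Fin k) → (Fin nV → Fin nV → Bool) → Vec (Subset k) k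
image² χ C = tabulate λ a → tabulate λ b →
  anyF λ v → anyF λ w → C v w ∧ ⌊ χ v ≟ a ⌋ ∧ ⌊ χ w ≟ b ⌋

-- label of a node with bag Bg whose parent bag is P (P = ∅ at the root)
mkLabel : ∀ {K nV} → (Fin nV → Fin (suc K)) → (Fin nV → Fin nV → Bool) →
          Subset nV → Subset nV → Sym K
mkLabel χ E Bg P = image χ A , image χ (Bg ─ A) , image² χ C
  where
    A = Bg ∩ P
    C : _ → _ → Bool
    C v w = E v w ∧ lookup Bg v ∧ lookup Bg w ∧ not (lookup A v ∧ lookup A w)

labelAt' : ∀ {K nV} → (Fin nV → Fin (suc K)) → (Fin nV → Fin nV → Bool) →
           (Pos → Subset nV) → Subset nV → Pos → Sym K
labelAt' χ E bag P [] = mkLabel χ E (bag []) P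
labelAt' χ E bag P (d ∷ p) = labelAt' χ E (λ x → bag (d ∷ x)) (bag []) p

Λ : ∀ {K nV} → (Fin nV → Fin (suc K)) → (Fin nV → Fin nV → Bool) →
    (Pos → Subset nV) → Pos → Sym K
Λ χ E bag = labelAt' χ E bag ⊥

module Run {S : Set} (𝒜 : Automaton S) where
  open Automaton 𝒜

  run : BTree → (Pos → S) → Fin q
  run leaf lab = δ ι ι (lab [])
  run (node l r) lab = δ (run l (λ p → lab (L ∷ p))) (run r (λ p → lab (R ∷ p))) (lab [])

  Accepts : BTree → (Pos → S) → Set
  Accepts t lab = run t lab ∈ Qend

-- The labeled graph Γ_G.
-- Functions π : S_i → Q are represented by raw functions Pos → Q, identified
-- when they agree on S_i (setoid); paths and Dyck matching are up to this.

module Gamma {K : ℕ} (𝒜 : Automaton (Sym K)) (t : BTree) (lab : Pos → Sym K) where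
  open Automaton 𝒜

  N : ℕ
  N = size t

  Agree : ℕ → (Pos → Fin q) → (Pos → Fin q) → Set
  Agree i π π' = ∀ n → InS t i n → π n ≡ π' n

  data Vtx : Set where
    st   : ℕ → (Pos → Fin q) → Vtx
    mid  : ℕ → Vtx
    midγ : ℕ → Sym K → Vtx
    top  : Vtx

  data Lab : Set where
    plus  : ℕ → (Pos → Fin q) → Lab
    minus : ℕ → (Pos → Fin q) → Lab
    bullet : Lab

  data _≈_ : Vtx → Vtx → Set where
    st≈   : ∀ {i π π'} → Agree i π π' → st i π ≈ st i π'
    mid≈  : ∀ {i} → mid i ≈ mid i
    midγ≈ : ∀ {i γ} → midγ i γ ≈ midγ i γ
    top≈  : top ≈ top

  PiRel : ℕ → (Pos → Fin q) → Sym K → (Pos → Fin q) → Set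
  PiRel j π γ π' = ∀ n → InS t (suc j) n →
    (InS t j n → π' n ≡ π n) ×
    (post t n ≡ suc j →
       (At t n leaf → π' n ≡ δ ι ι γ) ×
       (∀ l r → At t n (node l r) →
          π' n ≡ δ (π (n ++ [ L ])) (π (n ++ [ R ])) γ))

  -- edges of Γ_G (for i = j+1 with 1 ≤ i ≤ N)
  data Edge : Vtx → Lab → Vtx → Set where
    e⁺ : ∀ {j} → j < N → (π : Pos → Fin q) → Edge (st j π) (plus j π) (mid j)
    e⁻ : ∀ {j} → j < N → (π : Pos → Fin q) (γ : Sym K) (π' : Pos → Fin q) →
         PiRel j π γ π' → Edge (midγ j γ) (minus j π) (st (suc j) π')
    e• : ∀ {j} → j < N → (n : Pos) → IsNode t n → post t n ≡ suc j →
         Edge (mid j) bullet (midγ j (lab n))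
    e⊤ : (π : Pos → Fin q) (n : Pos) → IsNode t n → post t n ≡ N →
         π n ∈ Qend → Edge (st N π) bullet top

  data Path : Vtx → Vtx → List Lab → Set where
    stop : ∀ {u v} → u ≈ v → Path u v []
    step : ∀ {u u' v w ℓ ls} → u ≈ u' → Edge u' ℓ v → Path v w ls → Path u w (ℓ ∷ ls)

  data Dyck : List Lab → Set where
    ε   : Dyck []
    dot : ∀ {u v} → Dyck u → Dyck v → Dyck (u ++ bullet ∷ v)
    brk : ∀ {u v w i π π'} → Dyck u → Dyck v → Dyck w → Agree i π π' →
          Dyck (u ++ plus i π ∷ v ++ minus i π' ∷ w)

  -- the start vertex (0 , π_init)  (S_0 = ∅, so any representative)
  start : Vtx
  start = st 0 (λ _ → ι)

-- Γ_G simulates the run of 𝒜 on t left to right: the vertex (i , π) records the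
-- states at the roots of the finished subtrees S_i, the edge labelled (i , π)⁺
-- forgets π, and the edge labelled (i , π')⁻ guesses the updated record.  The
-- Dyck condition pairs each (i , π')⁻ with an earlier (i , π)⁺ whose π agrees
-- with π' on S_i, so along a Dyck path every guess is the true one.  Hence, by
-- induction on i, the record at (i , π) agrees on S_i with the run, and the final
-- edge to ⊤ exists exactly when the state at the root is accepting.  Nothing about
-- G, the tree decomposition or χ enters: the equivalence holds for every labelling.
module Submission where

open import Defs
open import Data.Nat using (ℕ)
open import Data.Bool using (Bool; T)
open import Data.Fin using (Fin)
open import Data.Fin.Subset using (Subset; _∈_)
open import Data.List using (List)
open import Data.Product using (∃-syntax; _×_)
open import Function.Bundles using (_⇔_)

open import Data.Nat as ℕ using (zero; suc; _+_; _∸_; _≤_; _<_; z≤n; s≤s)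
open import Data.Nat.Properties
open import Data.List using ([]; _∷_; _++_; [_])
open import Data.List.Properties using (∷-injective; ∷-injectiveʳ; ++-conicalʳ)
open import Data.List.Membership.Propositional using () renaming (_∈_ to _∈ₗ_)
open import Data.List.Membership.Propositional.Properties using (∈-++⁻; ∈-++⁺ˡ; ∈-++⁺ʳ)
open import Data.List.Relation.Unary.Any using (here; there)
open import Data.List.Relation.Unary.All as All using (All; []; _∷_)
open import Data.Product using (_,_; proj₁; proj₂)
open import Data.Sum using (_⊎_; inj₁; inj₂)
open import Data.Unit using (⊤; tt)
open import Data.Empty using (⊥-elim)
open import Relation.Nullary using (¬_; yes; no)
open import Relation.Binary.PropositionalEquality using (_≡_; _≢_; refl; sym; trans; cong; cong₂; subst; module ≡-Reasoning)
open import Function.Bundles using (mk⇔)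

branch : Dir → BTree → BTree → BTree
branch L l r = l
branch R l r = r

At-child : ∀ {t n l r} d → At t n (node l r) → At t (n ++ [ d ]) (branch d l r)
At-child L here = goL here
At-child R here = goR here
At-child d (goL a) = goL (At-child d a)
At-child d (goR a) = goR (At-child d a)

post≥1 : ∀ t p → 1 ≤ post t p
post≥1 leaf p = ≤-refl
post≥1 (node l r) [] = s≤s z≤n
post≥1 (node l r) (L ∷ p) = post≥1 l p
post≥1 (node l r) (R ∷ p) = ≤-trans (post≥1 r p) (m≤n+m _ (size l))

post≤size : ∀ t p → post t p ≤ size t
post≤size leaf p = ≤-refl
post≤size (node l r) [] = ≤-refl
post≤size (node l r) (L ∷ p) = m≤n⇒m≤1+n (≤-trans (post≤size l p) (m≤m+n (size l) (size r)))
post≤size (node l r) (R ∷ p) = m≤n⇒m≤1+n (+-monoʳ-≤ (size l) (post≤size r p))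

post-root : ∀ t → post t [] ≡ size t
post-root leaf = refl
post-root (node l r) = refl

post-below-root : ∀ l r d p → post (node l r) (d ∷ p) < post (node l r) []
post-below-root l r L p = s≤s (≤-trans (post≤size l p) (m≤m+n (size l) (size r)))
post-below-root l r R p = s≤s (+-monoʳ-≤ (size l) (post≤size r p))

post-left<right : ∀ l r p q → post (node l r) (L ∷ p) < post (node l r) (R ∷ q)
post-left<right l r p q = ≤-<-trans (post≤size l p) (m<m+n (size l) (post≥1 r q))

post-child< : ∀ {t n l r} d → At t n (node l r) → post t (n ++ [ d ]) < post t n
post-child< {l = l} {r} d here = post-below-root l r d []
post-child< d (goL a) = post-child< d a
post-child< {node l r} d (goR a) = +-monoʳ-< (size l) (post-child< d a)

post-injective : ∀ {t n m s s'} → At t n s → At t m s' → post t n ≡ post t m → n ≡ m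
post-injective here here e = refl
post-injective {node l r} here (goL {p = p} b) e = ⊥-elim (<-irrefl (sym e) (post-below-root l r L p))
post-injective {node l r} here (goR {p = p} b) e = ⊥-elim (<-irrefl (sym e) (post-below-root l r R p))
post-injective {node l r} (goL {p = p} a) here e = ⊥-elim (<-irrefl e (post-below-root l r L p))
post-injective {node l r} (goR {p = p} a) here e = ⊥-elim (<-irrefl e (post-below-root l r R p))
post-injective (goL a) (goL b) e = cong (L ∷_) (post-injective a b e)
post-injective (goR a) (goR b) e = cong (R ∷_) (post-injective a b (+-cancelˡ-≡ _ _ _ e))
post-injective {node l r} (goL {p = p} a) (goR {p = q} b) e = ⊥-elim (<-irrefl e (post-left<right l r p q))
post-injective {node l r} (goR {p = p} a) (goL {p = q} b) e = ⊥-elim (<-irrefl (sym e) (post-left<right l r q p))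

post-surjective : ∀ t i → 1 ≤ i → i ≤ size t → ∃[ n ] IsNode t n × post t n ≡ i
post-surjective leaf i 1≤i i≤1 = [] , (leaf , here) , ≤-antisym 1≤i i≤1
post-surjective (node l r) i 1≤i i≤N with i ≤? size l
... | yes i≤l with post-surjective l i 1≤i i≤l
...   | n , (s , a) , e = L ∷ n , (s , goL a) , e
post-surjective (node l r) i 1≤i i≤N | no i≰l with i ℕ.≟ suc (size l + size r)
... | yes i≡N = [] , (node l r , here) , sym i≡N
... | no i≢N with post-surjective r (i ∸ size l) (m<n⇒0<n∸m (≰⇒> i≰l)) i-l≤size-r
  where
  i-l≤size-r : i ∸ size l ≤ size r
  i-l≤size-r = subst (i ∸ size l ≤_) (m+n∸m≡n (size l) (size r))
                 (∸-monoˡ-≤ (size l) (≤-pred (≤∧≢⇒< i≤N i≢N)))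
...   | n , (s , a) , e = R ∷ n , (s , goR a) , trans (cong (size l +_) e) (m+[n∸m]≡n (<⇒≤ (≰⇒> i≰l)))

≺-snoc : ∀ a m d → a ≺ (m ++ [ d ]) → a ≡ m ⊎ a ≺ m
≺-snoc [] [] d (e , [] , refl) = inj₁ refl
≺-snoc [] [] d (e , _ ∷ _ , ())
≺-snoc [] (x ∷ m) d _ = inj₂ (x , m , refl)
≺-snoc (y ∷ a) [] d (e , s , eq) with ++-conicalʳ a (e ∷ s) (∷-injectiveʳ eq)
... | ()
≺-snoc (y ∷ a) (x ∷ m) d (e , s , eq) with ∷-injective eq
... | refl , eq′ with ≺-snoc a m d (e , s , eq′)
...   | inj₁ refl = inj₁ refl
...   | inj₂ (e′ , s′ , eq″) = inj₂ (e′ , s′ , cong (y ∷_) eq″)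

module RunLemmas {S : Set} (𝒜 : Automaton S) where
  open Automaton 𝒜
  open Run 𝒜

  -- positions outside the tree get the junk value ι
  stateAt : BTree → (Pos → S) → Pos → Fin q
  stateAt s lab [] = run s lab
  stateAt leaf lab (_ ∷ _) = ι
  stateAt (node l r) lab (L ∷ p) = stateAt l (λ x → lab (L ∷ x)) p
  stateAt (node l r) lab (R ∷ p) = stateAt r (λ x → lab (R ∷ x)) p

  stateAt-leaf : ∀ {s n lab} → At s n leaf → stateAt s lab n ≡ δ ι ι (lab n)
  stateAt-leaf here = refl
  stateAt-leaf (goL a) = stateAt-leaf a
  stateAt-leaf (goR a) = stateAt-leaf a

  stateAt-node : ∀ {s n l r lab} → At s n (node l r) →
                 stateAt s lab n ≡ δ (stateAt s lab (n ++ [ L ])) (stateAt s lab (n ++ [ R ])) (lab n)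
  stateAt-node here = refl
  stateAt-node (goL a) = stateAt-node a
  stateAt-node (goR a) = stateAt-node a

module Correctness {K : ℕ} (𝒜 : Automaton (Sym K)) (t : BTree) (lab : Pos → Sym K) where
  open Automaton 𝒜
  open Run 𝒜
  open RunLemmas 𝒜
  open Gamma 𝒜 t lab

  ρ : Pos → Fin q
  ρ = stateAt t lab

  S₀-empty : ∀ n → ¬ InS t 0 n
  S₀-empty n (_ , post≤0 , _) with ≤-trans (post≥1 t n) post≤0
  ... | ()

  agree-on-S₀ : ∀ π π′ → Agree 0 π π′
  agree-on-S₀ _ _ n n∈ = ⊥-elim (S₀-empty n n∈)

  root∈S_N : InS t N []
  root∈S_N = (t , here) , ≤-reflexive (post-root t) , λ { [] (_ , _ , ()) ; (_ ∷ _) (_ , _ , ()) }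

  InS-pred : ∀ {j m} → InS t (suc j) m → post t m ≢ suc j → InS t j m
  InS-pred (m∈ , post≤ , anc) post≢ =
    m∈ , ≤-pred (≤∧≢⇒< post≤ post≢) , λ a a≺m → <-trans (n<1+n _) (anc a a≺m)

  InS-child : ∀ {j m l r} d → InS t (suc j) m → post t m ≡ suc j → At t m (node l r) →
              InS t j (m ++ [ d ])
  InS-child {j} {m} {l} {r} d (_ , _ , anc) post≡ at =
    (branch d l r , At-child d at) , ≤-pred (≤-trans (post-child< d at) (≤-reflexive post≡)) , anc′
    where
    anc′ : ∀ a → a ≺ (m ++ [ d ]) → j < post t a
    anc′ a a≺ with ≺-snoc a m d a≺
    ... | inj₁ refl = ≤-reflexive (sym post≡)
    ... | inj₂ a≺m = <-trans (n<1+n _) (anc a a≺m)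

  run-satisfies-Π : ∀ {j n} → IsNode t n → post t n ≡ suc j → PiRel j ρ (lab n) ρ
  run-satisfies-Π {j} {n} (_ , atn) post-n m m∈ = (λ _ → refl) , λ post-m → at-leaf post-m , at-node post-m
    where
    m≡n : post t m ≡ suc j → m ≡ n
    m≡n post-m = post-injective (proj₂ (proj₁ m∈)) atn (trans post-m (sym post-n))
    at-leaf : post t m ≡ suc j → At t m leaf → ρ m ≡ δ ι ι (lab n)
    at-leaf post-m at with m≡n post-m
    ... | refl = stateAt-leaf at
    at-node : post t m ≡ suc j → ∀ l r → At t m (node l r) →
              ρ m ≡ δ (ρ (m ++ [ L ])) (ρ (m ++ [ R ])) (lab n)
    at-node post-m l r at with m≡n post-m
    ... | refl = stateAt-node at

  Π-new-node : ∀ {j π π′ n} → Agree j π ρ → PiRel j π (lab n) π′ →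
               InS t (suc j) n → post t n ≡ suc j → π′ n ≡ ρ n
  Π-new-node ag Π n∈@((leaf , at) , _) post-n =
    trans (proj₁ (proj₂ (Π _ n∈) post-n) at) (sym (stateAt-leaf at))
  Π-new-node {π = π} {π′} {n} ag Π n∈@((node l r , at) , _) post-n = begin
    π′ n                                       ≡⟨ proj₂ (proj₂ (Π n n∈) post-n) l r at ⟩
    δ (π (n ++ [ L ])) (π (n ++ [ R ])) (lab n) ≡⟨ cong₂ (λ x y → δ x y (lab n))
                                                    (ag _ (InS-child L n∈ post-n at))
                                                    (ag _ (InS-child R n∈ post-n at)) ⟩
    δ (ρ (n ++ [ L ])) (ρ (n ++ [ R ])) (lab n) ≡⟨ sym (stateAt-node at) ⟩
    ρ n                                        ∎
    where open ≡-Reasoning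

  Π-preserves-run : ∀ {j π π′ n} → IsNode t n → post t n ≡ suc j →
                    Agree j π ρ → PiRel j π (lab n) π′ → Agree (suc j) π′ ρ
  Π-preserves-run {j} (_ , atn) post-n ag Π m m∈ with post t m ℕ.≟ suc j
  ... | no post≢ = trans (proj₁ (Π m m∈) (InS-pred m∈ post≢)) (ag m (InS-pred m∈ post≢))
  ... | yes post-m with post-injective (proj₂ (proj₁ m∈)) atn (trans post-m (sym post-n))
  ...   | refl = Π-new-node ag Π m∈ post-m

  Matched : List Lab → Set
  Matched ls = ∀ {i π′} → minus i π′ ∈ₗ ls → ∃[ π ] plus i π ∈ₗ ls × Agree i π π′

  Matched-++ : ∀ {u v} → Matched u → Matched v → Matched (u ++ v)
  Matched-++ {u} mu mv m with ∈-++⁻ u m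
  ... | inj₁ m∈u = let π , p∈ , ag = mu m∈u in π , ∈-++⁺ˡ p∈ , ag
  ... | inj₂ m∈v = let π , p∈ , ag = mv m∈v in π , ∈-++⁺ʳ u p∈ , ag

  Matched-bullet : ∀ {v} → Matched v → Matched (bullet ∷ v)
  Matched-bullet mv (there m) = let π , p∈ , ag = mv m in π , there p∈ , ag

  Matched-bracket : ∀ {i π π′ v w} → Agree i π π′ → Matched v → Matched w →
                    Matched (plus i π ∷ v ++ minus i π′ ∷ w)
  Matched-bracket {v = v} ag mv mw (there m) with ∈-++⁻ v m
  ... | inj₁ m∈v = let π , p∈ , ag′ = mv m∈v in π , there (∈-++⁺ˡ p∈) , ag′
  ... | inj₂ (here refl) = _ , here refl , ag
  ... | inj₂ (there m∈w) = let π , p∈ , ag′ = mw m∈w in π , there (∈-++⁺ʳ v (there p∈)) , ag′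

  Dyck⇒Matched : ∀ {ls} → Dyck ls → Matched ls
  Dyck⇒Matched ε ()
  Dyck⇒Matched (dot du dv) = Matched-++ (Dyck⇒Matched du) (Matched-bullet (Dyck⇒Matched dv))
  Dyck⇒Matched (brk du dv dw ag) =
    Matched-++ (Dyck⇒Matched du) (Matched-bracket ag (Dyck⇒Matched dv) (Dyck⇒Matched dw))

  _≤ℓ_ : ℕ → Lab → Set
  k ≤ℓ plus i _ = k ≤ i
  k ≤ℓ minus i _ = k ≤ i
  k ≤ℓ bullet = ⊤

  ≤ℓ-weaken : ∀ {k k′} → k ≤ k′ → ∀ {ℓ} → k′ ≤ℓ ℓ → k ≤ℓ ℓ
  ≤ℓ-weaken k≤k′ {plus _ _} k′≤i = ≤-trans k≤k′ k′≤i
  ≤ℓ-weaken k≤k′ {minus _ _} k′≤i = ≤-trans k≤k′ k′≤i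
  ≤ℓ-weaken k≤k′ {bullet} tt = tt

  index : Vtx → ℕ
  index (st i _) = i
  index (mid i) = i
  index (midγ i _) = i
  index top = 0

  path-labels-≥ : ∀ {u ls} → Path u top ls → All (index u ≤ℓ_) ls
  path-labels-≥ (stop _) = []
  path-labels-≥ (step (st≈ _) (e⁺ _ _) p) = ≤-refl ∷ path-labels-≥ p
  path-labels-≥ (step mid≈ (e• _ _ _ _) p) = tt ∷ path-labels-≥ p
  path-labels-≥ (step midγ≈ (e⁻ _ _ _ _ _) p) = ≤-refl ∷ All.map (≤ℓ-weaken (n≤1+n _)) (path-labels-≥ p)
  path-labels-≥ (step (st≈ _) (e⊤ _ _ _ _ _) (stop _)) = tt ∷ []
  path-labels-≥ (step (st≈ _) (e⊤ _ _ _ _ _) (step top≈ () _))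

  -- All later labels carry indices > j, so (j , π₁)⁻ can only be matched by the head.
  head-Matched : ∀ {j π₀ π₁ rest} → All (suc j ≤ℓ_) rest →
                 Matched (plus j π₀ ∷ bullet ∷ minus j π₁ ∷ rest) → Agree j π₀ π₁ × Matched rest
  head-Matched {j} {rest = rest} later m = head-agrees , rest-matched
    where
    head-agrees : Agree j _ _
    head-agrees with m (there (there (here refl)))
    ... | _ , here refl , ag = ag
    ... | _ , there (there (there p∈)) , _ = ⊥-elim (<-irrefl refl (All.lookup later p∈))
    rest-matched : Matched rest
    rest-matched m∈ with m (there (there (there m∈)))
    ... | _ , here refl , _ = ⊥-elim (<-irrefl refl (All.lookup later m∈))
    ... | π , there (there (there p∈)) , ag = π , p∈ , ag

  accepts-from : ∀ {j π ls} → Agree j π ρ → Path (st j π) top ls → Matched ls → Accepts t lab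
  accepts-from _ (stop ())
  accepts-from ag (step (st≈ ag₀) (e⊤ π₀ n (_ , at) post-n final) _) _
    with post-injective at here (trans post-n (sym (post-root t)))
  ... | refl = subst (_∈ Qend) (trans (sym (ag₀ [] root∈S_N)) (ag [] root∈S_N)) final
  accepts-from _ (step _ (e⁺ _ _) (stop ()))
  accepts-from _ (step _ (e⁺ _ _) (step _ (e• _ _ _ _) (stop ())))
  accepts-from ag (step (st≈ ag₀) (e⁺ _ _) (step mid≈ (e• _ n n∈ post-n) (step midγ≈ (e⁻ _ _ _ _ Π) p))) m
    with head-Matched (path-labels-≥ p) m
  ... | ag₀₁ , m′ = accepts-from (Π-preserves-run n∈ post-n ag₁ Π) p m′
    where
    ag₁ : Agree _ _ ρ
    ag₁ k k∈ = trans (sym (ag₀₁ k k∈)) (trans (sym (ag₀ k k∈)) (ag k k∈))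

  -- the word read along the path that guesses the true run at every step
  runWord : ℕ → ℕ → List Lab
  runWord j zero = bullet ∷ []
  runWord j (suc k) = plus j ρ ∷ bullet ∷ minus j ρ ∷ runWord (suc j) k

  runWord-Dyck : ∀ j k → Dyck (runWord j k)
  runWord-Dyck j zero = dot ε ε
  runWord-Dyck j (suc k) = brk ε (dot ε ε) (runWord-Dyck (suc j) k) (λ _ _ → refl)

  +-suc≡⇒< : ∀ {j k n} → j + suc k ≡ n → j < n
  +-suc≡⇒< {j} eq = subst (j <_) eq (m<m+n j (s≤s z≤n))

  runPath : Accepts t lab → ∀ k j {π} → j + k ≡ N → Agree j π ρ → Path (st j π) top (runWord j k)
  runPath acc zero j j+0≡N ag rewrite +-identityʳ j | j+0≡N =
    step (st≈ ag) (e⊤ ρ [] (t , here) (post-root t) acc) (stop top≈)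
  runPath acc (suc k) j j+k+1≡N ag with post-surjective t (suc j) (s≤s z≤n) (+-suc≡⇒< j+k+1≡N)
  ... | n , n∈ , post-n =
    step (st≈ ag) (e⁺ j<N ρ) (step mid≈ (e• j<N n n∈ post-n)
      (step midγ≈ (e⁻ j<N ρ (lab n) ρ (run-satisfies-Π n∈ post-n))
        (runPath acc k (suc j) (trans (sym (+-suc j k)) j+k+1≡N) (λ _ _ → refl))))
    where
    j<N : j < N
    j<N = +-suc≡⇒< j+k+1≡N

  accepts⇔dyck-path : Accepts t lab ⇔ (∃[ ls ] Path start top ls × Dyck ls)
  accepts⇔dyck-path = mk⇔
    (λ acc → runWord 0 N , runPath acc N 0 refl (agree-on-S₀ _ ρ) , runWord-Dyck 0 N)
    (λ (ls , p , d) → accepts-from (agree-on-S₀ _ ρ) p (Dyck⇒Matched d))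

proposition1 : (κ : ℕ) (𝒜 : Automaton (Sym (Kof κ)))
    (nV : ℕ) (E⋆ : Fin nV → Fin nV → Bool)
    (t : BTree) (bag : Pos → Subset nV) (χ : Fin nV → Fin (ℕ.suc (Kof κ))) →
    IsTreeDecomposition (Kof κ) nV E⋆ t bag →
    ProperColoring (Kof κ) nV t bag χ →
    (E : Fin nV → Fin nV → Bool) → (∀ v w → T (E v w) → T (E⋆ v w)) →
    Run.Accepts 𝒜 t (Λ χ E bag)
    ⇔ (∃[ ls ] Gamma.Path 𝒜 t (Λ χ E bag) (Gamma.start 𝒜 t (Λ χ E bag)) (Gamma.top) ls
    × Gamma.Dyck 𝒜 t (Λ χ E bag) ls)
proposition1 κ 𝒜 nV E⋆ t bag χ _ _ E _ = Correctness.accepts⇔dyck-path 𝒜 t (Λ χ E bag)
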